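{- Let $G$ be a finite graph with a perfect matching $M$, and let $\mathcal{C}$ be a compatible $M$-alternating set of $G$. Let $S\subseteq E(G)\setminus M$ consist of precisely one edge from each cycle in $\mathcal{C}$. If $S$ anti-forces all the other edges in $E(\mathcal{C})\cap (E(G)\setminus M)$ (where $E(\mathcal{C})$ is the set of edges of the cycles in $\mathcal{C}$), then $$af(G,M)=af\big(G\ominus S,\ M\cap E(G\ominus S)\big)+|S|.$$
   Context: A perfect matching of $G$ is a set of pairwise disjoint edges covering all vertices. For a perfect matching $M$ of $G$, an anti-forcing set of $M$ is a subset $S\subseteq E(G)\setminus M$ such that $G-S$ (the graph obtained from $G$ by deleting the edges of $S$) has $M$ as its unique perfect matching; the anti-forcing number $af(G,M)$ is the minimum cardinality of an anti-forcing set of $M$ (it is $0$ for the empty graph). A cycle of $G$ is $M$-alternating if its edges alternate between $M$ and $E(G)\setminus M$. Two $M$-alternating cycles are compatible if they are disjoint or intersect only at edges of $M$; a compatible $M$-alternating set is a set of $M$-alternating cycles any two of which are compatible. For $S\subseteq E(G)\setminus M$, an edge of $G-S$ is forced by $S$ if it belongs to every perfect matching of $G-S$, and anti-forced by $S$ if it belongs to no perfect matching of $G-S$. $G\ominus S$ denotes the subgraph obtained from $G-S$ by deleting the end vertices of all edges forced by $S$ and deleting all edges anti-forced by $S$; $M\cap E(G\ominus S)$ is a perfect matching of $G\ominus S$. -}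

module Defs where

open import Data.Nat using (ℕ; suc; _+_; _≤_)
open import Data.Nat.DivMod using (_mod_)
open import Data.Fin using (Fin; toℕ)
open import Data.Fin.Subset using (Subset; _∈_; _∉_; ∣_∣)
open import Data.Product using (Σ; ∃; _×_; _,_)
open import Data.Sum using (_⊎_)
open import Data.Unit using (⊤)
open import Relation.Nullary using (¬_)
open import Relation.Binary.PropositionalEquality using (_≡_; _≢_)
open import Function.Bundles using (_⇔_)

record Graph : Set where
  field
    n m      : ℕ
    src tgt  : Fin m → Fin n
    loopless : ∀ e → src e ≢ tgt e
    simple   : ∀ e e' →
               ((src e ≡ src e' × tgt e ≡ tgt e') ⊎ (src e ≡ tgt e' × tgt e ≡ src e')) →
               e ≡ e'

module _ (G : Graph) where
  open Graph G

  Joins : Fin m → Fin n → Fin n → Set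
  Joins e u v = (src e ≡ u × tgt e ≡ v) ⊎ (src e ≡ v × tgt e ≡ u)

  Incident : Fin m → Fin n → Set
  Incident e v = (src e ≡ v) ⊎ (tgt e ≡ v)

  record Sub : Set₁ where
    field
      vtx : Fin n → Set
      edg : Fin m → Set
  open Sub public

  whole : Sub
  whole = record { vtx = λ _ → ⊤ ; edg = λ _ → ⊤ }

  _─_ : Sub → Subset m → Sub
  H ─ S = record { vtx = vtx H ; edg = λ e → edg H e × e ∉ S }

  IsPM : Sub → (Fin m → Set) → Set
  IsPM H N = (∀ e → N e → edg H e)
           × (∀ v → vtx H v →
               (∃ λ e → N e × Incident e v)
               × (∀ e e' → N e → Incident e v → N e' → Incident e' v → e ≡ e'))

  -- M is the unique perfect matching of H (perfect matchings are finite edge sets).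
  UniquePM : Sub → (Fin m → Set) → Set
  UniquePM H M = IsPM H M × (∀ (N : Subset m) → IsPM H (_∈ N) → ∀ e → (e ∈ N ⇔ M e))

  AntiForcing : Sub → (Fin m → Set) → Subset m → Set
  AntiForcing H M S = (∀ e → e ∈ S → edg H e × ¬ M e) × UniquePM (H ─ S) M

  IsAF : Sub → (Fin m → Set) → ℕ → Set
  IsAF H M k = (∃ λ (S : Subset m) → AntiForcing H M S × ∣ S ∣ ≡ k)
             × (∀ (S : Subset m) → AntiForcing H M S → k ≤ ∣ S ∣)

  Forced : Subset m → Fin m → Set
  Forced S e = e ∉ S × (∀ (N : Subset m) → IsPM (whole ─ S) (_∈ N) → e ∈ N)

  AntiForced : Subset m → Fin m → Set
  AntiForced S e = e ∉ S × (∀ (N : Subset m) → IsPM (whole ─ S) (_∈ N) → e ∉ N)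

  _⊖_ : Subset m → Sub
  _⊖_ S = record
    { vtx = λ v → ¬ (∃ λ e → Forced S e × Incident e v)
    ; edg = λ e → e ∉ S × ¬ AntiForced S e
                  × ¬ (∃ λ f → Forced S f × Incident f (src e))
                  × ¬ (∃ λ f → Forced S f × Incident f (tgt e)) }

  next : ∀ {k} → Fin (suc k) → Fin (suc k)
  next {k} i = suc (toℕ i) mod (suc k)

  record Cycle : Set where
    field
      j     : ℕ
      vert  : Fin (3 + j) → Fin n
      edge  : Fin (3 + j) → Fin m
      vert-inj : ∀ a b → vert a ≡ vert b → a ≡ b
      joins : ∀ a → Joins (edge a) (vert a) (vert (next a))

  InE : Cycle → Fin m → Set
  InE C e = ∃ λ a → Cycle.edge C a ≡ e

  InV : Cycle → Fin n → Set
  InV C v = ∃ λ a → Cycle.vert C a ≡ v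

  Alternating : Subset m → Cycle → Set
  Alternating M C = ∀ a → (Cycle.edge C a ∈ M ⇔ Cycle.edge C (next a) ∉ M)

  Compatible : Subset m → Cycle → Cycle → Set
  Compatible M C D =
      (∀ v → InV C v → ¬ InV D v)
    ⊎ ((∀ e → InE C e → InE D e → e ∈ M)
       × (∀ v → InV C v → InV D v → ∃ λ e → InE C e × InE D e × e ∈ M × Incident e v))

-- Write H = G ⊖ S and M′ = M ∩ E(H). For any S ⊆ E(G) ∖ M the perfect matchings
-- of G − S are exactly the perfect matchings of H extended by the edges forced by S.
-- Hence T′ ↦ T′ ∪ S sends anti-forcing sets of M′ in H to anti-forcing sets of M
-- in G, and T ↦ T ∩ E(H) sends them back; so af(G,M) ≤ af(H,M′) + |S| and
-- af(H,M′) ≤ |T ∩ E(H)| for every anti-forcing set T of M in G.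
-- The cycle hypotheses give |T ∖ E(H)| ≥ |S|: T contains a non-M edge of every
-- M-alternating cycle (otherwise flipping M along the cycle yields a second perfect
-- matching of G − T); such an edge is in S or anti-forced by S, hence not in E(H);
-- and the edges found on distinct cycles of 𝒞 differ, since compatible cycles
-- share only M-edges.

module Submission where

open import Defs
open import Level using (0ℓ)
open import Data.Nat using (ℕ; zero; suc; _+_; _≤_; _<_; z≤n; s≤s; s≤s⁻¹)
import Data.Nat.Properties as ℕ
open import Data.Nat.DivMod using (_%_; m<n⇒m%n≡m; n%n≡0)
open import Data.Fin using (Fin; zero; suc; toℕ; fromℕ; inject₁; _≟_)
import Data.Fin.Properties as Fin
open import Data.Fin.Subset
  using (Subset; inside; outside; _∈_; _∉_; ∣_∣; _∪_; _∩_; _-_; Empty)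
  renaming (_─_ to _∖_)
open import Data.Fin.Subset.Properties
  using ( _∈?_; x∈p∪q⁻; x∈p∪q⁺; x∈p∩q⁻; x∈p∩q⁺; x∈p∧x∉q⇒x∈p─q; x∈p∧x≢y⇒x∈p-y
        ; x∈p⇒∣p-x∣<∣p∣; Empty-unique; ∣⊥∣≡0; anySubset?)
open import Data.Vec using ([]; _∷_; here; there)
open import Data.Product using (∃; _×_; _,_; proj₁; proj₂)
open import Data.Sum using (_⊎_; inj₁; inj₂)
open import Data.Empty using (⊥-elim)
open import Data.Unit using (⊤; tt)
open import Function using (_∘_)
open import Function.Bundles using (_⇔_; mk⇔; Equivalence)
open import Function.Construct.Symmetry using (⇔-sym)
open import Relation.Nullary using (Dec; yes; no; does; ¬?; ¬_)
open import Relation.Nullary.Decidable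
  using (map′; decidable-stable; _×-dec_; _⊎-dec_; _→-dec_)
open import Relation.Unary using (Pred; Decidable)
open import Relation.Binary.PropositionalEquality
  using (_≡_; _≢_; refl; sym; trans; cong; subst; module ≡-Reasoning)

open Equivalence using (to; from)

∣p∪q∣+∣p∩q∣≡∣p∣+∣q∣ : ∀ {n} (p q : Subset n) → ∣ p ∪ q ∣ + ∣ p ∩ q ∣ ≡ ∣ p ∣ + ∣ q ∣
∣p∪q∣+∣p∩q∣≡∣p∣+∣q∣ []            []            = refl
∣p∪q∣+∣p∩q∣≡∣p∣+∣q∣ (inside  ∷ p) (inside  ∷ q) =
  cong suc (trans (ℕ.+-suc _ _) (trans (cong suc (∣p∪q∣+∣p∩q∣≡∣p∣+∣q∣ p q)) (sym (ℕ.+-suc _ _))))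
∣p∪q∣+∣p∩q∣≡∣p∣+∣q∣ (inside  ∷ p) (outside ∷ q) = cong suc (∣p∪q∣+∣p∩q∣≡∣p∣+∣q∣ p q)
∣p∪q∣+∣p∩q∣≡∣p∣+∣q∣ (outside ∷ p) (inside  ∷ q) =
  trans (cong suc (∣p∪q∣+∣p∩q∣≡∣p∣+∣q∣ p q)) (sym (ℕ.+-suc _ _))
∣p∪q∣+∣p∩q∣≡∣p∣+∣q∣ (outside ∷ p) (outside ∷ q) = ∣p∪q∣+∣p∩q∣≡∣p∣+∣q∣ p q

∣p∪q∣≡∣p∣+∣q∣ : ∀ {n} (p q : Subset n) → Empty (p ∩ q) → ∣ p ∪ q ∣ ≡ ∣ p ∣ + ∣ q ∣
∣p∪q∣≡∣p∣+∣q∣ {n} p q p∩q-empty = begin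
  ∣ p ∪ q ∣               ≡⟨ sym (ℕ.+-identityʳ _) ⟩
  ∣ p ∪ q ∣ + 0           ≡⟨ cong (∣ p ∪ q ∣ +_) (sym (trans (cong ∣_∣ (Empty-unique p∩q-empty)) (∣⊥∣≡0 n))) ⟩
  ∣ p ∪ q ∣ + ∣ p ∩ q ∣   ≡⟨ ∣p∪q∣+∣p∩q∣≡∣p∣+∣q∣ p q ⟩
  ∣ p ∣ + ∣ q ∣           ∎
  where open ≡-Reasoning

∣p∣≡∣p∩q∣+∣p∖q∣ : ∀ {n} (p q : Subset n) → ∣ p ∣ ≡ ∣ p ∩ q ∣ + ∣ p ∖ q ∣
∣p∣≡∣p∩q∣+∣p∖q∣ []            []            = refl
∣p∣≡∣p∩q∣+∣p∖q∣ (inside  ∷ p) (inside  ∷ q) = cong suc (∣p∣≡∣p∩q∣+∣p∖q∣ p q)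
∣p∣≡∣p∩q∣+∣p∖q∣ (inside  ∷ p) (outside ∷ q) =
  trans (cong suc (∣p∣≡∣p∩q∣+∣p∖q∣ p q)) (sym (ℕ.+-suc _ _))
∣p∣≡∣p∩q∣+∣p∖q∣ (outside ∷ p) (inside  ∷ q) = ∣p∣≡∣p∩q∣+∣p∖q∣ p q
∣p∣≡∣p∩q∣+∣p∖q∣ (outside ∷ p) (outside ∷ q) = ∣p∣≡∣p∩q∣+∣p∖q∣ p q

injective⇒∣p∣≤∣q∣ : ∀ {n n′} (p : Subset n) (q : Subset n′) (f : ∀ {x} → x ∈ p → Fin n′) →
                    (∀ {x} (x∈p : x ∈ p) → f x∈p ∈ q) →
                    (∀ {x y} (x∈p : x ∈ p) (y∈p : y ∈ p) → f x∈p ≡ f y∈p → x ≡ y) →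
                    ∣ p ∣ ≤ ∣ q ∣
injective⇒∣p∣≤∣q∣ []            q f f∈q f-inj = z≤n
injective⇒∣p∣≤∣q∣ (outside ∷ p) q f f∈q f-inj =
  injective⇒∣p∣≤∣q∣ p q (f ∘ there) (f∈q ∘ there)
    (λ x∈p y∈p eq → Fin.suc-injective (f-inj (there x∈p) (there y∈p) eq))
injective⇒∣p∣≤∣q∣ (inside  ∷ p) q f f∈q f-inj =
  ℕ.≤-trans (s≤s ∣p∣≤∣q-y∣) (x∈p⇒∣p-x∣<∣p∣ (f∈q here))
  where
    ∣p∣≤∣q-y∣ : ∣ p ∣ ≤ ∣ q - f here ∣
    ∣p∣≤∣q-y∣ = injective⇒∣p∣≤∣q∣ p (q - f here) (f ∘ there)
      (λ x∈p → x∈p∧x≢y⇒x∈p-y (f∈q (there x∈p)) (λ eq → Fin.0≢1+n (f-inj here (there x∈p) (sym eq))))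
      (λ x∈p y∈p eq → Fin.suc-injective (f-inj (there x∈p) (there y∈p) eq))

toSubset : ∀ {n} {P : Pred (Fin n) 0ℓ} → Decidable P → Subset n
toSubset {zero}  P? = []
toSubset {suc n} P? = does (P? zero) ∷ toSubset (P? ∘ suc)

∈toSubset⁺ : ∀ {n} {P : Pred (Fin n) 0ℓ} (P? : Decidable P) {x} → P x → x ∈ toSubset P?
∈toSubset⁺ P? {zero}  Px with P? zero
... | yes _  = here
... | no ¬Px = ⊥-elim (¬Px Px)
∈toSubset⁺ P? {suc x} Px = there (∈toSubset⁺ (P? ∘ suc) Px)

∈toSubset⁻ : ∀ {n} {P : Pred (Fin n) 0ℓ} (P? : Decidable P) {x} → x ∈ toSubset P? → P x
∈toSubset⁻ P? {zero}  x∈ with P? zero | x∈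
... | yes Px | _ = Px
∈toSubset⁻ P? {suc x} (there x∈) = ∈toSubset⁻ (P? ∘ suc) x∈

allSubset? : ∀ {n} {P : Pred (Subset n) 0ℓ} → Decidable P → Dec (∀ N → P N)
allSubset? P? = map′
  (λ ¬∃¬P N → decidable-stable (P? N) (λ ¬PN → ¬∃¬P (N , ¬PN)))
  (λ ∀P (N , ¬PN) → ¬PN (∀P N))
  (¬? (anySubset? (¬? ∘ P?)))

module _ (G : Graph) where
  open Graph G

  G─_ : Subset m → Sub G
  G─ S = _─_ G (whole G) S

  G⊖_ : Subset m → Sub G
  G⊖ S = _⊖_ G S

  toℕ-next : ∀ {k} (a : Fin (suc k)) →
             toℕ (next G a) ≡ suc (toℕ a) ⊎ (toℕ (next G a) ≡ 0 × toℕ a ≡ k)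
  toℕ-next {k} a with ℕ.m≤n⇒m<n∨m≡n (s≤s⁻¹ (Fin.toℕ<n a))
  ... | inj₁ a<k = inj₁ (trans (Fin.toℕ-fromℕ< _) (m<n⇒m%n≡m (s≤s a<k)))
  ... | inj₂ a≡k = inj₂ (trans (Fin.toℕ-fromℕ< _)
                           (trans (cong (λ t → suc t % suc k) a≡k) (n%n≡0 (suc k))) , a≡k)

  next-injective : ∀ {k} {a b : Fin (suc k)} → next G a ≡ next G b → a ≡ b
  next-injective {a = a} {b} eq with toℕ-next a | toℕ-next b
  ... | inj₁ na | inj₁ nb = Fin.toℕ-injective (ℕ.suc-injective (trans (sym na) (trans (cong toℕ eq) nb)))
  ... | inj₂ (_ , a≡k) | inj₂ (_ , b≡k) = Fin.toℕ-injective (trans a≡k (sym b≡k))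
  ... | inj₁ na | inj₂ (nb , _) with () ← trans (sym na) (trans (cong toℕ eq) nb)
  ... | inj₂ (na , _) | inj₁ nb with () ← trans (sym nb) (trans (cong toℕ (sym eq)) na)

  next-surjective : ∀ {k} (a : Fin (suc k)) → ∃ λ p → next G p ≡ a
  next-surjective {k} zero = fromℕ k , Fin.toℕ-injective
    (trans (Fin.toℕ-fromℕ< _) (trans (cong (λ t → suc t % suc k) (Fin.toℕ-fromℕ k)) (n%n≡0 (suc k))))
  next-surjective {suc k} (suc a) = inject₁ a , Fin.toℕ-injective
    (trans (Fin.toℕ-fromℕ< _)
      (trans (m<n⇒m%n≡m (s≤s (subst (_< suc k) (sym (Fin.toℕ-inject₁ a)) (Fin.toℕ<n a))))
             (cong suc (Fin.toℕ-inject₁ a))))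

  module _ (C : Cycle G) where
    open Cycle C

    edge-ends : ∀ b {v} → Incident G (edge b) v → v ≡ vert b ⊎ v ≡ vert (next G b)
    edge-ends b inc with joins b | inc
    ... | inj₁ (s , _) | inj₁ s≡v = inj₁ (trans (sym s≡v) s)
    ... | inj₁ (_ , t) | inj₂ t≡v = inj₂ (trans (sym t≡v) t)
    ... | inj₂ (s , _) | inj₁ s≡v = inj₂ (trans (sym s≡v) s)
    ... | inj₂ (_ , t) | inj₂ t≡v = inj₁ (trans (sym t≡v) t)

    edge-incident-vert : ∀ a → Incident G (edge a) (vert a)
    edge-incident-vert a with joins a
    ... | inj₁ (s , _) = inj₁ s
    ... | inj₂ (_ , t) = inj₂ t

    edge-incident-next : ∀ a → Incident G (edge a) (vert (next G a))
    edge-incident-next a with joins a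
    ... | inj₁ (_ , t) = inj₂ t
    ... | inj₂ (s , _) = inj₁ s

    InE⇒InV : ∀ {e v} → InE G C e → Incident G e v → InV G C v
    InE⇒InV (b , refl) inc with edge-ends b inc
    ... | inj₁ v≡ = b , sym v≡
    ... | inj₂ v≡ = next G b , sym v≡

    incident-edge-index : ∀ {a b} → Incident G (edge b) (vert a) → b ≡ a ⊎ next G b ≡ a
    incident-edge-index {a} {b} inc with edge-ends b inc
    ... | inj₁ v≡ = inj₁ (sym (vert-inj a b v≡))
    ... | inj₂ v≡ = inj₂ (sym (vert-inj a (next G b) v≡))

  Incident? : ∀ e v → Dec (Incident G e v)
  Incident? e v = (src e ≟ v) ⊎-dec (tgt e ≟ v)

  InE? : ∀ C → Decidable (InE G C)
  InE? C e = Fin.any? λ a → Cycle.edge C a ≟ e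

  InV? : ∀ C → Decidable (InV G C)
  InV? C v = Fin.any? λ a → Cycle.vert C a ≟ v

  IsPM-─? : ∀ S (N : Subset m) → Dec (IsPM G (G─ S) (_∈ N))
  IsPM-─? S N =
    Fin.all? (λ e → (e ∈? N) →-dec (yes tt ×-dec ¬? (e ∈? S)))
    ×-dec Fin.all? (λ v → yes tt →-dec
            ((Fin.any? λ e → (e ∈? N) ×-dec Incident? e v)
             ×-dec Fin.all? λ e → Fin.all? λ e′ →
                     (e ∈? N) →-dec Incident? e v →-dec (e′ ∈? N) →-dec Incident? e′ v →-dec (e ≟ e′)))

  Forced? : ∀ S → Decidable (Forced G S)
  Forced? S e = ¬? (e ∈? S) ×-dec allSubset? (λ N → IsPM-─? S N →-dec (e ∈? N))

  AntiForced? : ∀ S → Decidable (AntiForced G S)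
  AntiForced? S e = ¬? (e ∈? S) ×-dec allSubset? (λ N → IsPM-─? S N →-dec ¬? (e ∈? N))

  ForcedAt? : ∀ S v → Dec (∃ λ f → Forced G S f × Incident G f v)
  ForcedAt? S v = Fin.any? λ f → Forced? S f ×-dec Incident? f v

  E⊖? : ∀ S → Decidable (edg (G⊖ S))
  E⊖? S e = ¬? (e ∈? S) ×-dec ¬? (AntiForced? S e)
            ×-dec ¬? (ForcedAt? S (src e)) ×-dec ¬? (ForcedAt? S (tgt e))

  CoveredOnce : (Fin m → Set) → Fin n → Set
  CoveredOnce N v = (∃ λ e → N e × Incident G e v)
                  × (∀ e e′ → N e → Incident G e v → N e′ → Incident G e′ v → e ≡ e′)

  module _ {H : Sub G} {N : Fin m → Set} (N-isPM : IsPM G H N) where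

    matched-edge : ∀ {v} → vtx H v → ∃ λ e → N e × Incident G e v
    matched-edge v∈H = proj₁ (proj₂ N-isPM _ v∈H)

    matched-edge-unique : ∀ {v e e′} → vtx H v → N e → Incident G e v → N e′ → Incident G e′ v → e ≡ e′
    matched-edge-unique v∈H = proj₂ (proj₂ N-isPM _ v∈H) _ _

  IsPM-resp : ∀ {H : Sub G} {P Q : Fin m → Set} → (∀ e → P e ⇔ Q e) → IsPM G H P → IsPM G H Q
  IsPM-resp {H} {Q = Q} P⇔Q (P⊆E , P-covers) = (λ e → P⊆E e ∘ from (P⇔Q e)) , Q-covers
    where
      Q-covers : ∀ v → vtx H v → CoveredOnce Q v
      Q-covers v v∈H = let ((e , Pe , inc) , P-unique) = P-covers v v∈H in
        (e , to (P⇔Q e) Pe , inc) ,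
        λ e e′ Qe inc Qe′ inc′ → P-unique e e′ (from (P⇔Q e) Qe) inc (from (P⇔Q e′) Qe′) inc′

  IsPM-─⁺ : ∀ {H : Sub G} {N : Fin m → Set} {T} → IsPM G H N → (∀ e → N e → e ∉ T) → IsPM G (_─_ G H T) N
  IsPM-─⁺ (N⊆E , covers) avoid = (λ e Ne → N⊆E e Ne , avoid e Ne) , covers

  IsPM-─⁻ : ∀ {H : Sub G} {N : Fin m → Set} {T} → IsPM G (_─_ G H T) N → IsPM G H N × (∀ e → N e → e ∉ T)
  IsPM-─⁻ (N⊆E , covers) = ((λ e → proj₁ ∘ N⊆E e) , covers) , (λ e → proj₂ ∘ N⊆E e)

  compatible-common-edge∈M : ∀ {M} C D {e} → Compatible G M C D → InE G C e → InE G D e → e ∈ M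
  compatible-common-edge∈M C D (inj₁ disjoint) e∈C e∈D =
    ⊥-elim (disjoint _ (InE⇒InV C e∈C (inj₁ refl)) (InE⇒InV D e∈D (inj₁ refl)))
  compatible-common-edge∈M C D (inj₂ (common⊆M , _)) e∈C e∈D = common⊆M _ e∈C e∈D

  -- Flipping a perfect matching along an alternating cycle

  Flipped : Subset m → Cycle G → Fin m → Set
  Flipped M C e = (e ∈ M × ¬ InE G C e) ⊎ (e ∉ M × InE G C e)

  Flipped? : ∀ M C e → Dec (Flipped M C e)
  Flipped? M C e = ((e ∈? M) ×-dec ¬? (InE? C e)) ⊎-dec (¬? (e ∈? M) ×-dec InE? C e)

  _⊕_ : Subset m → Cycle G → Subset m
  M ⊕ C = toSubset (Flipped? M C)

  ⊕-differs : ∀ M C → ¬ (∀ e → e ∈ M ⊕ C ⇔ e ∈ M)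
  ⊕-differs M C same with Cycle.edge C zero ∈? M
  ... | yes e∈M with ∈toSubset⁻ (Flipped? M C) (from (same _) e∈M)
  ...   | inj₁ (_ , e∉C) = e∉C (zero , refl)
  ...   | inj₂ (e∉M , _) = e∉M e∈M
  ⊕-differs M C same | no e∉M = e∉M (to (same _) (∈toSubset⁺ (Flipped? M C) (inj₂ (e∉M , zero , refl))))

  module _ {M : Subset m} (M-isPM : IsPM G (whole G) (_∈ M)) (C : Cycle G) (alt : Alternating G M C) where
    open Cycle C

    M-edge-at : ∀ a → ∃ λ b → edge b ∈ M × Incident G (edge b) (vert a)
    M-edge-at a with edge a ∈? M | next-surjective a
    ... | yes a∈M | _      = a , a∈M , edge-incident-vert C a
    ... | no a∉M  | p , refl = p , from (alt p) a∉M , edge-incident-next C p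

    non-M-edge-at : ∀ a → ∃ λ b → edge b ∉ M × Incident G (edge b) (vert a)
    non-M-edge-at a with edge a ∈? M | next-surjective a
    ... | no a∉M  | _      = a , a∉M , edge-incident-vert C a
    ... | yes a∈M | p , refl = p , (λ p∈M → to (alt p) p∈M a∈M) , edge-incident-next C p

    non-M-edge-unique : ∀ {a b b′} → edge b ∉ M → edge b′ ∉ M →
                        Incident G (edge b) (vert a) → Incident G (edge b′) (vert a) → b ≡ b′
    non-M-edge-unique {b = b} {b′} b∉M b′∉M inc inc′
      with incident-edge-index C inc | incident-edge-index C inc′
    ... | inj₁ b≡a   | inj₁ b′≡a   = trans b≡a (sym b′≡a)
    ... | inj₂ b+1≡a | inj₂ b′+1≡a = next-injective (trans b+1≡a (sym b′+1≡a))
    ... | inj₁ refl  | inj₂ refl   = ⊥-elim (b′∉M (from (alt b′) b∉M))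
    ... | inj₂ refl  | inj₁ refl   = ⊥-elim (b∉M (from (alt b) b′∉M))

    ⊕-covers-cycle-vertex : ∀ a → CoveredOnce (_∈ M ⊕ C) (vert a)
    ⊕-covers-cycle-vertex a =
      let (b , b∉M , inc) = non-M-edge-at a in
      (edge b , ∈toSubset⁺ (Flipped? M C) (inj₂ (b∉M , b , refl)) , inc) , unique
      where
        non-M-cycle-edge : ∀ {e} → e ∈ M ⊕ C → Incident G e (vert a) → ∃ λ b → edge b ≡ e × edge b ∉ M
        non-M-cycle-edge e∈ inc with ∈toSubset⁻ (Flipped? M C) e∈
        ... | inj₂ (e∉M , b , refl) = b , refl , e∉M
        ... | inj₁ (e∈M , e∉C) =
          let (b , b∈M , inc-b) = M-edge-at a in
          ⊥-elim (e∉C (b , matched-edge-unique M-isPM tt b∈M inc-b e∈M inc))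
        unique : ∀ e e′ → e ∈ M ⊕ C → Incident G e (vert a) → e′ ∈ M ⊕ C → Incident G e′ (vert a) → e ≡ e′
        unique e e′ e∈ inc e′∈ inc′ with non-M-cycle-edge e∈ inc | non-M-cycle-edge e′∈ inc′
        ... | b , refl , b∉M | b′ , refl , b′∉M = cong edge (non-M-edge-unique b∉M b′∉M inc inc′)

    ⊕-covers-off-cycle : ∀ {v} → ¬ InV G C v → CoveredOnce (_∈ M ⊕ C) v
    ⊕-covers-off-cycle {v} v∉C =
      let (e , e∈M , inc) = matched-edge M-isPM tt in
      (e , ∈toSubset⁺ (Flipped? M C) (inj₁ (e∈M , λ e∈C → v∉C (InE⇒InV C e∈C inc))) , inc) ,
      λ e e′ e∈ inc e′∈ inc′ → matched-edge-unique M-isPM tt (∈M e∈ inc) inc (∈M e′∈ inc′) inc′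
      where
        ∈M : ∀ {e} → e ∈ M ⊕ C → Incident G e v → e ∈ M
        ∈M e∈ inc with ∈toSubset⁻ (Flipped? M C) e∈
        ... | inj₁ (e∈M , _) = e∈M
        ... | inj₂ (_ , e∈C) = ⊥-elim (v∉C (InE⇒InV C e∈C inc))

    ⊕-isPM : IsPM G (whole G) (_∈ M ⊕ C)
    ⊕-isPM = (λ _ _ → tt) , covered
      where
        covered : ∀ v → ⊤ → CoveredOnce (_∈ M ⊕ C) v
        covered v _ with InV? C v
        ... | yes (a , refl) = ⊕-covers-cycle-vertex a
        ... | no v∉C         = ⊕-covers-off-cycle v∉C

  -- Otherwise M ⊕ C would be a second perfect matching of G − T.
  antiForcing-meets-alternating-cycle :
    ∀ {M T} → IsPM G (whole G) (_∈ M) → AntiForcing G (whole G) (_∈ M) T →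
    ∀ C → Alternating G M C → ∃ λ e → e ∈ T × InE G C e × e ∉ M
  antiForcing-meets-alternating-cycle {M} {T} M-isPM (T⊆E∖M , _ , M-unique) C alt
    with Fin.any? (λ a → (Cycle.edge C a ∈? T) ×-dec ¬? (Cycle.edge C a ∈? M))
  ... | yes (a , a∈T , a∉M) = Cycle.edge C a , a∈T , (a , refl) , a∉M
  ... | no T-misses-C =
    ⊥-elim (⊕-differs M C (M-unique (M ⊕ C) (IsPM-─⁺ {T = T} (⊕-isPM M-isPM C alt) avoids-T)))
    where
      avoids-T : ∀ e → e ∈ M ⊕ C → e ∉ T
      avoids-T e e∈ e∈T with ∈toSubset⁻ (Flipped? M C) e∈
      ... | inj₁ (e∈M , _)        = proj₂ (T⊆E∖M e e∈T) e∈M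
      ... | inj₂ (e∉M , a , refl) = T-misses-C (a , e∈T , e∉M)

  IsAF-shift : ∀ {H₁ H₂ : Sub G} {M₁ M₂ : Fin m → Set} (s : ℕ) (φ ψ : Subset m → Subset m) →
               (∀ T → AntiForcing G H₁ M₁ T → AntiForcing G H₂ M₂ (φ T) × ∣ φ T ∣ ≡ ∣ T ∣ + s) →
               (∀ T → AntiForcing G H₂ M₂ T → AntiForcing G H₁ M₁ (ψ T) × ∣ ψ T ∣ + s ≤ ∣ T ∣) →
               ∀ k → IsAF G H₁ M₁ k ⇔ IsAF G H₂ M₂ (k + s)
  IsAF-shift {H₁} {H₂} {M₁} {M₂} s φ ψ φ-af ψ-af k = mk⇔ forward backward
    where
      cancel-s : ∀ {a b} → a + s ≤ b + s → a ≤ b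
      cancel-s = ℕ.+-cancelʳ-≤ s _ _

      forward : IsAF G H₁ M₁ k → IsAF G H₂ M₂ (k + s)
      forward ((T , T-af , refl) , T-min) =
        (φ T , φ-af T T-af) ,
        λ T₂ T₂-af → ℕ.≤-trans (ℕ.+-monoˡ-≤ s (T-min (ψ T₂) (proj₁ (ψ-af T₂ T₂-af)))) (proj₂ (ψ-af T₂ T₂-af))

      backward : IsAF G H₂ M₂ (k + s) → IsAF G H₁ M₁ k
      backward ((T₂ , T₂-af , ∣T₂∣≡k+s) , T₂-min) =
        (ψ T₂ , ψT₂-af , ℕ.≤-antisym (cancel-s (subst (∣ ψ T₂ ∣ + s ≤_) ∣T₂∣≡k+s (proj₂ (ψ-af T₂ T₂-af))))
                                      (cancel-s (k+s≤∣T∣+s (ψ T₂) ψT₂-af))) ,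
        λ T T-af → cancel-s (k+s≤∣T∣+s T T-af)
        where
          ψT₂-af : AntiForcing G H₁ M₁ (ψ T₂)
          ψT₂-af = proj₁ (ψ-af T₂ T₂-af)
          k+s≤∣T∣+s : ∀ T → AntiForcing G H₁ M₁ T → k + s ≤ ∣ T ∣ + s
          k+s≤∣T∣+s T T-af = subst (k + s ≤_) (proj₂ (φ-af T T-af)) (T₂-min (φ T) (proj₁ (φ-af T T-af)))

  -- Perfect matchings of G − S and of G ⊖ S

  -- Opaque because unfolding the decision procedure for E(G ⊖ S) during
  -- unification makes type checking take minutes.
  opaque
    E⊖ : Subset m → Subset m
    E⊖ S = toSubset (E⊖? S)

    ∈E⊖⁺ : ∀ {S e} → edg (G⊖ S) e → e ∈ E⊖ S
    ∈E⊖⁺ {S} = ∈toSubset⁺ (E⊖? S)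

    ∈E⊖⁻ : ∀ {S e} → e ∈ E⊖ S → edg (G⊖ S) e
    ∈E⊖⁻ {S} = ∈toSubset⁻ (E⊖? S)

  opaque
    forcedEdges : Subset m → Subset m
    forcedEdges S = toSubset (Forced? S)

    ∈forcedEdges⁺ : ∀ {S e} → Forced G S e → e ∈ forcedEdges S
    ∈forcedEdges⁺ {S} = ∈toSubset⁺ (Forced? S)

    ∈forcedEdges⁻ : ∀ {S e} → e ∈ forcedEdges S → Forced G S e
    ∈forcedEdges⁻ {S} = ∈toSubset⁻ (Forced? S)

  ∈∩E⊖⇔ : ∀ {S N e} → e ∈ N ∩ E⊖ S ⇔ (e ∈ N × edg (G⊖ S) e)
  ∈∩E⊖⇔ {S} {N} = mk⇔
    (λ e∈ → let (e∈N , e∈E⊖) = x∈p∩q⁻ N (E⊖ S) e∈ in e∈N , ∈E⊖⁻ e∈E⊖)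
    (λ (e∈N , e∈E⊖) → x∈p∩q⁺ (e∈N , ∈E⊖⁺ e∈E⊖))

  module _ (S : Subset m) where

    E⊖-ends-in-V⊖ : ∀ {e v} → edg (G⊖ S) e → Incident G e v → vtx (G⊖ S) v
    E⊖-ends-in-V⊖ (_ , _ , src-free , _) (inj₁ refl) = src-free
    E⊖-ends-in-V⊖ (_ , _ , _ , tgt-free) (inj₂ refl) = tgt-free

    Forced⇒∉E⊖ : ∀ {f} → Forced G S f → ¬ edg (G⊖ S) f
    Forced⇒∉E⊖ {f} f-forced f∈E⊖ = E⊖-ends-in-V⊖ f∈E⊖ (inj₁ refl) (f , f-forced , inj₁ refl)

    -- e is neither in S nor anti-forced (it lies in N), so an end of e meets a
    -- forced edge f; since f ∈ N as well, e = f.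
    ∉E⊖⇒Forced : ∀ {N e} → IsPM G (G─ S) (_∈ N) → e ∈ N → ¬ edg (G⊖ S) e → Forced G S e
    ∉E⊖⇒Forced {N} {e} N-isPM e∈N e∉E⊖ with ForcedAt? S (src e) | ForcedAt? S (tgt e)
    ... | yes (f , f-forced , inc) | _ =
      subst (Forced G S) (matched-edge-unique N-isPM tt (proj₂ f-forced N N-isPM) inc e∈N (inj₁ refl))
            f-forced
    ... | no _ | yes (f , f-forced , inc) =
      subst (Forced G S) (matched-edge-unique N-isPM tt (proj₂ f-forced N N-isPM) inc e∈N (inj₂ refl))
            f-forced
    ... | no src-free | no tgt-free =
      ⊥-elim (e∉E⊖ (proj₂ (proj₁ N-isPM e e∈N) , (λ e-anti → proj₂ e-anti N N-isPM e∈N) ,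
                    src-free , tgt-free))

    restrict-isPM : ∀ {N} → IsPM G (G─ S) (_∈ N) → IsPM G (G⊖ S) (λ e → e ∈ N × edg (G⊖ S) e)
    restrict-isPM {N} N-isPM = (λ _ → proj₂) , covered
      where
        covered : ∀ v → vtx (G⊖ S) v → CoveredOnce (λ e → e ∈ N × edg (G⊖ S) e) v
        covered v v-free = let (e , e∈N , inc) = matched-edge N-isPM tt in
          (e , (e∈N , e∈E⊖ e∈N inc) , inc) ,
          λ _ _ x inc x′ inc′ → matched-edge-unique N-isPM tt (proj₁ x) inc (proj₁ x′) inc′
          where
            e∈E⊖ : ∀ {e} → e ∈ N → Incident G e v → edg (G⊖ S) e
            e∈E⊖ {e} e∈N inc with E⊖? S e
            ... | yes e∈E⊖ = e∈E⊖
            ... | no e∉E⊖  = ⊥-elim (v-free (e , ∉E⊖⇒Forced N-isPM e∈N e∉E⊖ , inc))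

    extend-isPM : ∀ {M N} → IsPM G (G─ S) (_∈ M) → IsPM G (G⊖ S) (_∈ N) →
                  IsPM G (G─ S) (_∈ N ∪ forcedEdges S)
    extend-isPM {M} {N} M-isPM (N⊆E⊖ , N-covers) = N∪F⊆E , covered
      where
        N∪F⊆E : ∀ e → e ∈ N ∪ forcedEdges S → ⊤ × e ∉ S
        N∪F⊆E e e∈ with x∈p∪q⁻ N (forcedEdges S) e∈
        ... | inj₁ e∈N = tt , proj₁ (N⊆E⊖ e e∈N)
        ... | inj₂ e∈F = tt , proj₁ (∈forcedEdges⁻ e∈F)
        covered : ∀ v → ⊤ → CoveredOnce (_∈ N ∪ forcedEdges S) v
        covered v _ with ForcedAt? S v
        ... | yes (f , f-forced , inc-f) =
          (f , x∈p∪q⁺ (inj₂ (∈forcedEdges⁺ f-forced)) , inc-f) ,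
          λ e e′ e∈ inc e′∈ inc′ → matched-edge-unique M-isPM tt (∈M e∈ inc) inc (∈M e′∈ inc′) inc′
          where
            ∈M : ∀ {e} → e ∈ N ∪ forcedEdges S → Incident G e v → e ∈ M
            ∈M e∈ inc with x∈p∪q⁻ N (forcedEdges S) e∈
            ... | inj₁ e∈N = ⊥-elim (E⊖-ends-in-V⊖ (N⊆E⊖ _ e∈N) inc (f , f-forced , inc-f))
            ... | inj₂ e∈F = proj₂ (∈forcedEdges⁻ e∈F) M M-isPM
        ... | no v-free = let ((e , e∈N , inc) , N-unique) = N-covers v v-free in
          (e , x∈p∪q⁺ (inj₁ e∈N) , inc) ,
          λ e e′ e∈ inc e′∈ inc′ → N-unique e e′ (∈N e∈ inc) inc (∈N e′∈ inc′) inc′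
          where
            ∈N : ∀ {e} → e ∈ N ∪ forcedEdges S → Incident G e v → e ∈ N
            ∈N e∈ inc with x∈p∪q⁻ N (forcedEdges S) e∈
            ... | inj₁ e∈N = e∈N
            ... | inj₂ e∈F = ⊥-elim (v-free (_ , ∈forcedEdges⁻ e∈F , inc))

  module _ {M : Subset m} (M-isPM : IsPM G (whole G) (_∈ M))
           {S : Subset m} (S∩M=∅ : ∀ e → e ∈ S → e ∉ M) where

    M⊖ : Fin m → Set
    M⊖ e = e ∈ M × edg (G⊖ S) e

    M-isPM-─S : IsPM G (G─ S) (_∈ M)
    M-isPM-─S = IsPM-─⁺ M-isPM (λ e e∈M e∈S → S∩M=∅ e e∈S e∈M)

    agree-on-E⊖⇒agree : ∀ {N} → IsPM G (G─ S) (_∈ N) →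
                        (∀ e → e ∈ N ∩ E⊖ S ⇔ M⊖ e) → ∀ e → e ∈ N ⇔ e ∈ M
    agree-on-E⊖⇒agree {N} N-isPM agree e with E⊖? S e
    ... | yes e∈E⊖ = mk⇔ (λ e∈N → proj₁ (to (agree e) (from ∈∩E⊖⇔ (e∈N , e∈E⊖))))
                         (λ e∈M → proj₁ (to ∈∩E⊖⇔ (from (agree e) (e∈M , e∈E⊖))))
    ... | no e∉E⊖ = mk⇔ (λ e∈N → proj₂ (∉E⊖⇒Forced S N-isPM e∈N e∉E⊖) M M-isPM-─S)
                        (λ e∈M → proj₂ (∉E⊖⇒Forced S M-isPM-─S e∈M e∉E⊖) N N-isPM)

    ∪S-antiForcing : ∀ {T′} → AntiForcing G (G⊖ S) M⊖ T′ → AntiForcing G (whole G) (_∈ M) (T′ ∪ S)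
    ∪S-antiForcing {T′} (T′⊆E⊖∖M⊖ , _ , M⊖-unique) =
      T′∪S⊆E∖M , IsPM-─⁺ M-isPM (λ e e∈M e∈ → proj₂ (T′∪S⊆E∖M e e∈) e∈M) , M-unique
      where
        T′∪S⊆E∖M : ∀ e → e ∈ T′ ∪ S → ⊤ × e ∉ M
        T′∪S⊆E∖M e e∈ with x∈p∪q⁻ T′ S e∈
        ... | inj₁ e∈T′ = tt , λ e∈M → proj₂ (T′⊆E⊖∖M⊖ e e∈T′) (e∈M , proj₁ (T′⊆E⊖∖M⊖ e e∈T′))
        ... | inj₂ e∈S  = tt , S∩M=∅ e e∈S
        M-unique : ∀ N → IsPM G (G─ (T′ ∪ S)) (_∈ N) → ∀ e → e ∈ N ⇔ e ∈ M
        M-unique N N-isPM = agree-on-E⊖⇒agree N-isPM-─S (M⊖-unique (N ∩ E⊖ S) N∩E⊖-isPM)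
          where
            avoids : ∀ e → e ∈ N → e ∉ T′ ∪ S
            avoids = proj₂ (IsPM-─⁻ N-isPM)
            N-isPM-─S : IsPM G (G─ S) (_∈ N)
            N-isPM-─S = IsPM-─⁺ (proj₁ (IsPM-─⁻ N-isPM)) (λ e e∈N e∈S → avoids e e∈N (x∈p∪q⁺ (inj₂ e∈S)))
            N∩E⊖-isPM : IsPM G (_─_ G (G⊖ S) T′) (_∈ N ∩ E⊖ S)
            N∩E⊖-isPM = IsPM-─⁺ (IsPM-resp (λ _ → ⇔-sym ∈∩E⊖⇔) (restrict-isPM S N-isPM-─S))
              (λ e e∈ e∈T′ → avoids e (proj₁ (to ∈∩E⊖⇔ e∈)) (x∈p∪q⁺ (inj₁ e∈T′)))

    ∩E⊖-antiForcing : ∀ {T} → AntiForcing G (whole G) (_∈ M) T → AntiForcing G (G⊖ S) M⊖ (T ∩ E⊖ S)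
    ∩E⊖-antiForcing {T} (T⊆E∖M , _ , M-unique) =
      T∩E⊖⊆E⊖∖M⊖ ,
      IsPM-─⁺ (restrict-isPM S M-isPM-─S) (λ e (e∈M , _) e∈ → proj₂ (T⊆E∖M e (proj₁ (to ∈∩E⊖⇔ e∈))) e∈M) ,
      M⊖-unique
      where
        T∩E⊖⊆E⊖∖M⊖ : ∀ e → e ∈ T ∩ E⊖ S → edg (G⊖ S) e × ¬ M⊖ e
        T∩E⊖⊆E⊖∖M⊖ e e∈ = let (e∈T , e∈E⊖) = to ∈∩E⊖⇔ e∈ in
          e∈E⊖ , λ (e∈M , _) → proj₂ (T⊆E∖M e e∈T) e∈M
        M⊖-unique : ∀ N → IsPM G (_─_ G (G⊖ S) (T ∩ E⊖ S)) (_∈ N) → ∀ e → e ∈ N ⇔ M⊖ e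
        M⊖-unique N N-isPM e = mk⇔
          (λ e∈N → to (N∪F≡M e) (x∈p∪q⁺ (inj₁ e∈N)) , proj₁ (N⊆E⊖∖T e e∈N))
          (λ (e∈M , e∈E⊖) → ∈N (from (N∪F≡M e) e∈M) e∈E⊖)
          where
            N⊆E⊖∖T : ∀ e → e ∈ N → edg (G⊖ S) e × e ∉ T ∩ E⊖ S
            N⊆E⊖∖T = proj₁ N-isPM
            avoids-T : ∀ e → e ∈ N ∪ forcedEdges S → e ∉ T
            avoids-T e e∈ e∈T with x∈p∪q⁻ N (forcedEdges S) e∈
            ... | inj₁ e∈N = let (e∈E⊖ , e∉T∩E⊖) = N⊆E⊖∖T e e∈N in e∉T∩E⊖ (from ∈∩E⊖⇔ (e∈T , e∈E⊖))
            ... | inj₂ e∈F = proj₂ (T⊆E∖M e e∈T) (proj₂ (∈forcedEdges⁻ e∈F) M M-isPM-─S)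
            N∪F≡M : ∀ e → e ∈ N ∪ forcedEdges S ⇔ e ∈ M
            N∪F≡M = M-unique (N ∪ forcedEdges S)
              (IsPM-─⁺ (proj₁ (IsPM-─⁻ (extend-isPM S M-isPM-─S (proj₁ (IsPM-─⁻ N-isPM))))) avoids-T)
            ∈N : ∀ {e} → e ∈ N ∪ forcedEdges S → edg (G⊖ S) e → e ∈ N
            ∈N e∈ e∈E⊖ with x∈p∪q⁻ N (forcedEdges S) e∈
            ... | inj₁ e∈N = e∈N
            ... | inj₂ e∈F = ⊥-elim (Forced⇒∉E⊖ S (∈forcedEdges⁻ e∈F) e∈E⊖)

∣S∣≤∣T∖E⊖∣ : (G : Graph) {M : Subset (Graph.m G)} → IsPM G (whole G) (_∈ M) →
             ∀ {c} (𝒞 : Fin c → Cycle G) → (∀ i → Alternating G M (𝒞 i)) →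
             (∀ i i′ → i ≢ i′ → Compatible G M (𝒞 i) (𝒞 i′)) →
             ∀ {S} → (∀ i {e e′} → e ∈ S → e′ ∈ S → InE G (𝒞 i) e → InE G (𝒞 i) e′ → e ≡ e′) →
             (∀ e → e ∈ S → ∃ λ i → InE G (𝒞 i) e) →
             (∀ e → (∃ λ i → InE G (𝒞 i) e) → e ∉ M → e ∉ S → AntiForced G S e) →
             ∀ {T} → AntiForcing G (whole G) (_∈ M) T → ∣ S ∣ ≤ ∣ T ∖ E⊖ G S ∣
∣S∣≤∣T∖E⊖∣ G {M} M-isPM 𝒞 alt compat {S} one-per-cycle S⊆⋃𝒞 anti {T} T-af =
  injective⇒∣p∣≤∣q∣ S (T ∖ E⊖ G S) (proj₁ ∘ hit) hit∈T∖E⊖ hit-injective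
  where
    cycle-of : ∀ {e} → e ∈ S → Fin _
    cycle-of e∈S = proj₁ (S⊆⋃𝒞 _ e∈S)

    hit : ∀ {e} (e∈S : e ∈ S) → ∃ λ g → g ∈ T × InE G (𝒞 (cycle-of e∈S)) g × g ∉ M
    hit e∈S = antiForcing-meets-alternating-cycle G M-isPM T-af (𝒞 (cycle-of e∈S)) (alt (cycle-of e∈S))

    hit∈T∖E⊖ : ∀ {e} (e∈S : e ∈ S) → proj₁ (hit e∈S) ∈ T ∖ E⊖ G S
    hit∈T∖E⊖ e∈S with hit e∈S
    ... | g , g∈T , g∈C , g∉M = x∈p∧x∉q⇒x∈p─q g∈T (g∉E⊖ ∘ ∈E⊖⁻ G)
      where
        g∉E⊖ : ¬ edg (_⊖_ G S) g
        g∉E⊖ (g∉S , g-not-anti , _) = g-not-anti (anti g (_ , g∈C) g∉M g∉S)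

    hit-injective : ∀ {e e′} (e∈S : e ∈ S) (e′∈S : e′ ∈ S) → proj₁ (hit e∈S) ≡ proj₁ (hit e′∈S) → e ≡ e′
    hit-injective e∈S e′∈S same with S⊆⋃𝒞 _ e∈S | S⊆⋃𝒞 _ e′∈S | hit e∈S | hit e′∈S
    ... | i , e∈C | i′ , e′∈C′ | g , _ , g∈C , g∉M | _ , _ , g′∈C′ , _ with i ≟ i′
    ...   | yes refl = one-per-cycle i e∈S e′∈S e∈C e′∈C′
    ...   | no i≢i′  = ⊥-elim (g∉M (compatible-common-edge∈M G (𝒞 i) (𝒞 i′) (compat i i′ i≢i′)
                                   g∈C (subst (InE G (𝒞 i′)) (sym same) g′∈C′)))

lemma2p4 : (G : Graph) (M : Subset (Graph.m G))
    → IsPM G (whole G) (_∈ M)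
    → (c : ℕ) (𝒞 : Fin c → Cycle G)
    → (∀ i → Alternating G M (𝒞 i))
    → (∀ i i' → i ≢ i' → Compatible G M (𝒞 i) (𝒞 i'))
    → (S : Subset (Graph.m G))
    → (∀ e → e ∈ S → e ∉ M)
    → (∀ i → ∃ λ e → e ∈ S × InE G (𝒞 i) e × (∀ e' → e' ∈ S → InE G (𝒞 i) e' → e' ≡ e))
    → (∀ e → e ∈ S → ∃ λ i → InE G (𝒞 i) e)
    → (∀ e → (∃ λ i → InE G (𝒞 i) e) → e ∉ M → e ∉ S → AntiForced G S e)
    → ∀ k → (IsAF G (_⊖_ G S) (λ e → e ∈ M × edg (_⊖_ G S) e) k
             ⇔ IsAF G (whole G) (_∈ M) (k + ∣ S ∣))
lemma2p4 G M M-isPM c 𝒞 alt compat S S∩M=∅ one-S-edge-per-cycle S⊆⋃𝒞 anti =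
  IsAF-shift G ∣ S ∣ (_∪ S) (_∩ E⊖ G S)
    (λ T′ T′-af → ∪S-antiForcing G M-isPM S∩M=∅ T′-af , ∣p∪q∣≡∣p∣+∣q∣ T′ S (T′∩S-empty T′-af))
    (λ T T-af → ∩E⊖-antiForcing G M-isPM S∩M=∅ T-af , ∣T∩E⊖∣+∣S∣≤∣T∣ T-af)
  where
    T′∩S-empty : ∀ {T′} → AntiForcing G (_⊖_ G S) (λ e → e ∈ M × edg (_⊖_ G S) e) T′ → Empty (T′ ∩ S)
    T′∩S-empty {T′} (T′⊆E⊖ , _) (e , e∈) =
      let (e∈T′ , e∈S) = x∈p∩q⁻ T′ S e∈ in proj₁ (proj₁ (T′⊆E⊖ e e∈T′)) e∈S

    at-most-one : ∀ i {e e′} → e ∈ S → e′ ∈ S → InE G (𝒞 i) e → InE G (𝒞 i) e′ → e ≡ e′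
    at-most-one i e∈S e′∈S e∈C e′∈C =
      let (_ , _ , _ , unique) = one-S-edge-per-cycle i in
      trans (unique _ e∈S e∈C) (sym (unique _ e′∈S e′∈C))

    ∣T∩E⊖∣+∣S∣≤∣T∣ : ∀ {T} → AntiForcing G (whole G) (_∈ M) T → ∣ T ∩ E⊖ G S ∣ + ∣ S ∣ ≤ ∣ T ∣
    ∣T∩E⊖∣+∣S∣≤∣T∣ {T} T-af =
      subst (∣ T ∩ E⊖ G S ∣ + ∣ S ∣ ≤_) (sym (∣p∣≡∣p∩q∣+∣p∖q∣ T (E⊖ G S)))
        (ℕ.+-monoʳ-≤ ∣ T ∩ E⊖ G S ∣
          (∣S∣≤∣T∖E⊖∣ G M-isPM 𝒞 alt compat at-most-one S⊆⋃𝒞 anti T-af))
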